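{- Let $n\ge 2$, $b\ge 2$ and $1\le r<b$ be integers with $n\ge b-r-1$. Then the circulant graph $G_{nb+r,b}$ satisfies $\mathrm{box}(G_{nb+r,b})\le\chi(G_{nb+r,b})$.
   Context: For integers $a\ge 2b\ge 2$, the graph $G_{a,b}$ has vertex set $\{0,1,\dots,a-1\}$, and distinct vertices $u,v$ are adjacent if and only if $u\in\{v+b,v+b+1,\dots,v+a-b\}$, with addition modulo $a$. A box in Euclidean $k$-space is a Cartesian product of $k$ closed intervals of the real line. The boxicity $\mathrm{box}(G)$ of a graph $G$ is the minimum nonnegative integer $k$ such that $G$ is isomorphic to the intersection graph of a family of boxes in Euclidean $k$-space. $\chi(G)$ is the chromatic number of $G$. -}

module Defs where

open import Data.Nat using (ℕ; _+_; _∸_; _≤_)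
open import Data.Fin using (Fin; toℕ)
open import Data.Integer as ℤ using (ℤ)
open import Data.Product using (Σ; ∃; _×_)
open import Data.Sum using (_⊎_)
open import Relation.Binary.PropositionalEquality using (_≡_; _≢_)
open import Function.Bundles using (_⇔_)

-- Circulant graph G_{a,b} on vertex set {0,…,a-1} (= Fin a):
-- u ~ v  iff  u ≠ v and u ≡ v + k (mod a) for some b ≤ k ≤ a - b.
-- Since 0 ≤ toℕ v < a and k < a, "v + k mod a" is either v + k or v + k - a.
CircAdj : (a b : ℕ) → Fin a → Fin a → Set
CircAdj a b u v =
  u ≢ v × ∃ λ k → b ≤ k × k ≤ a ∸ b ×
    (toℕ u ≡ toℕ v + k ⊎ toℕ u + a ≡ toℕ v + k)

Colourable : (a b k : ℕ) → Set
Colourable a b k =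
  Σ (Fin a → Fin k) λ c → ∀ u v → CircAdj a b u v → c u ≢ c v

IsChromaticNumber : (a b χ : ℕ) → Set
IsChromaticNumber a b χ = Colourable a b χ × (∀ j → Colourable a b j → χ ≤ j)

record Box (k : ℕ) : Set where
  field
    lo hi : Fin k → ℤ
    lo≤hi : ∀ i → lo i ℤ.≤ hi i
open Box public

Intersect : ∀ {k} → Box k → Box k → Set
Intersect B C = ∀ i → (lo B i ℤ.≤ hi C i) × (lo C i ℤ.≤ hi B i)

BoxRepresentable : (a b k : ℕ) → Set
BoxRepresentable a b k =
  Σ (Fin a → Box k) λ B → ∀ u v → u ≢ v → (CircAdj a b u v ⇔ Intersect (B u) (B v))

module Submission where

-- Let a = n·b + r with n ≥ 2 and 1 ≤ r < b.  We show box(G_{a,b}) ≤ n + 1 ≤ χ(G_{a,b}).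
--
-- For each coordinate i ∈ {0,…,n} rebase the cycle at i·b
-- and give a vertex with offset o the interval [o,o] if o < b, [0,o-b] if b ≤ o < 2b and
-- [0,b] otherwise.  Two vertices at cyclic distance k with b ≤ k ≤ a-b get meeting
-- intervals in every coordinate (farOffsetsMeet); two vertices at cyclic distance
-- 0 < e < b both land in the window [0,2b) of the coordinate whose base i·b lies just
-- below the nearer one, and there the intervals are disjoint (nearOffsetsApart).
-- This works whenever 2b ≤ a ≤ (n+1)·b.
--
-- The vertices x, x+b, …, x+nb are pairwise adjacent
-- except for x and x+nb, so a colouring with at most n colours gives x and x+nb = x-r
-- the same colour.  Hence colours are invariant under +r, so 0 and the least multiple
-- q·r ≥ b (which satisfies q·r < b+r ≤ a-b) share a colour although they are adjacent.

open import Defs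
open import Data.Nat using (ℕ; _+_; _*_; _∸_; _≤_; _<_)
open import Data.Product using (∃; _×_)

open import Data.Nat.Base using (zero; suc; z≤n; s≤s; NonZero; >-nonZero; >-nonZero⁻¹)
open import Data.Nat.Properties
open import Data.Nat.DivMod
open import Algebra.Properties.CommutativeSemigroup +-commutativeSemigroup using (xy∙z≈xz∙y)
open import Data.Fin.Base using (Fin; toℕ; fromℕ<)
open import Data.Fin.Properties using (toℕ-injective; toℕ-fromℕ<; toℕ<n; pigeonhole)
open import Data.Integer.Base using (+≤+) renaming (+_ to pos)
open import Data.Integer.Properties using (drop‿+≤+)
open import Data.Product using (_,_; proj₁; proj₂; swap)
open import Data.Sum using (_⊎_; inj₁; inj₂)
open import Data.Empty using (⊥; ⊥-elim)
open import Relation.Nullary using (¬_; yes; no)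
open import Relation.Nullary.Decidable using (_×-dec_)
open import Relation.Binary.PropositionalEquality
open import Function.Bundles using (mk⇔)

CyclicShift : (a x y k : ℕ) → Set
CyclicShift a x y k = x ≡ y + k ⊎ x + a ≡ y + k

module Cycle (a : ℕ) .{{_ : NonZero a}} where
  open ≡-Reasoning

  %-absorbˡ : ∀ x z → (x % a + z) % a ≡ (x + z) % a
  %-absorbˡ x z = begin
    (x % a + z) % a          ≡⟨ %-distribˡ-+ (x % a) z a ⟩
    (x % a % a + z % a) % a  ≡⟨ cong (λ w → (w + z % a) % a) (m%n%n≡m%n x a) ⟩
    (x % a + z % a) % a      ≡⟨ %-distribˡ-+ x z a ⟨
    (x + z) % a              ∎

  shift⇒mod : ∀ {x y k} → x < a → CyclicShift a x y k → x ≡ (y + k) % a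
  shift⇒mod x<a (inj₁ refl) = sym (m<n⇒m%n≡m x<a)
  shift⇒mod {x} {y} {k} x<a (inj₂ x+a≡y+k) = begin
    x            ≡⟨ m<n⇒m%n≡m x<a ⟨
    x % a        ≡⟨ [m+n]%n≡m%n x a ⟨
    (x + a) % a  ≡⟨ cong (_% a) x+a≡y+k ⟩
    (y + k) % a  ∎

  mod⇒shift : ∀ {x y k} → y < a → k ≤ a → x ≡ (y + k) % a → CyclicShift a x y k
  mod⇒shift {y = y} {k} y<a k≤a refl with y + k <? a
  ... | yes y+k<a = inj₁ (m<n⇒m%n≡m y+k<a)
  ... | no  y+k≮a = inj₂ (begin
    (y + k) % a + a        ≡⟨ cong (_+ a) (m≤n⇒[n∸m]%m≡n%m a≤y+k) ⟨
    (y + k ∸ a) % a + a    ≡⟨ cong (_+ a) (m<n⇒m%n≡m (m<n+o⇒m∸n<o (y + k) a (+-mono-<-≤ y<a k≤a))) ⟩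
    (y + k ∸ a) + a        ≡⟨ m∸n+n≡m a≤y+k ⟩
    y + k                  ∎)
    where a≤y+k = ≮⇒≥ y+k≮a

  shift-moves : ∀ {x y k} → CyclicShift a x y k → 0 < k → k < a → x ≢ y
  shift-moves (inj₁ x≡y+k) 0<k _ refl = <⇒≢ (m<m+n _ 0<k) x≡y+k
  shift-moves (inj₂ x+a≡y+k) _ k<a refl = <⇒≢ k<a (sym (+-cancelˡ-≡ _ _ _ x+a≡y+k))

  -- The offset of x when the cycle is rebased at s, i.e. x - s modulo a.
  rotate : ℕ → ℕ → ℕ
  rotate s x = (x + (a ∸ s)) % a

  rotate<a : ∀ s x → rotate s x < a
  rotate<a s x = m%n<n (x + (a ∸ s)) a

  rotate-shift : ∀ s {x y k} → x ≡ (y + k) % a → rotate s x ≡ (rotate s y + k) % a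
  rotate-shift s {x} {y} {k} refl = begin
    ((y + k) % a + (a ∸ s)) % a  ≡⟨ %-absorbˡ (y + k) (a ∸ s) ⟩
    (y + k + (a ∸ s)) % a        ≡⟨ cong (_% a) (xy∙z≈xz∙y y k (a ∸ s)) ⟩
    (y + (a ∸ s) + k) % a        ≡⟨ %-absorbˡ (y + (a ∸ s)) k ⟨
    (rotate s y + k) % a         ∎

  rotate-below : ∀ {s y} → s ≤ y → y < a → rotate s y ≡ y ∸ s
  rotate-below {s} {y} s≤y y<a = begin
    (y + (a ∸ s)) % a  ≡⟨ cong (_% a) (+-∸-assoc y s≤a) ⟨
    (y + a ∸ s) % a    ≡⟨ cong (_% a) (+-∸-comm a s≤y) ⟩
    (y ∸ s + a) % a    ≡⟨ [m+n]%n≡m%n (y ∸ s) a ⟩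
    (y ∸ s) % a        ≡⟨ m<n⇒m%n≡m (≤-<-trans (m∸n≤m y s) y<a) ⟩
    y ∸ s              ∎
    where s≤a = ≤-trans s≤y (<⇒≤ y<a)

  rotate-distance : ∀ {x y} → x < a → y < a → x ≡ (y + rotate y x) % a
  rotate-distance {x} {y} x<a y<a = sym (begin
    (y + rotate y x) % a     ≡⟨ cong (_% a) (+-comm y (rotate y x)) ⟩
    (rotate y x + y) % a     ≡⟨ %-absorbˡ (x + (a ∸ y)) y ⟩
    (x + (a ∸ y) + y) % a    ≡⟨ cong (_% a) (+-assoc x (a ∸ y) y) ⟩
    (x + (a ∸ y + y)) % a    ≡⟨ cong (λ w → (x + w) % a) (m∸n+n≡m (<⇒≤ y<a)) ⟩
    (x + a) % a              ≡⟨ [m+n]%n≡m%n x a ⟩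
    x % a                    ≡⟨ m<n⇒m%n≡m x<a ⟩
    x                        ∎)

  reverse-distance : ∀ {x y d} → y < a → d ≤ a → x ≡ (y + d) % a → y ≡ (x + (a ∸ d)) % a
  reverse-distance {y = y} {d} y<a d≤a refl = sym (begin
    ((y + d) % a + (a ∸ d)) % a  ≡⟨ %-absorbˡ (y + d) (a ∸ d) ⟩
    (y + d + (a ∸ d)) % a        ≡⟨ cong (_% a) (+-assoc y d (a ∸ d)) ⟩
    (y + (d + (a ∸ d))) % a      ≡⟨ cong (λ w → (y + w) % a) (m+[n∸m]≡n d≤a) ⟩
    (y + a) % a                  ≡⟨ [m+n]%n≡m%n y a ⟩
    y % a                        ≡⟨ m<n⇒m%n≡m y<a ⟩
    y                            ∎)

  distance-positive : ∀ {x y} → x < a → y < a → x ≢ y → 0 < rotate y x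
  distance-positive {x} {y} x<a y<a x≢y with rotate y x in eq
  ... | suc _ = s≤s z≤n
  ... | zero  = ⊥-elim (x≢y (begin
    x                     ≡⟨ rotate-distance x<a y<a ⟩
    (y + rotate y x) % a  ≡⟨ cong (λ d → (y + d) % a) eq ⟩
    (y + 0) % a           ≡⟨ cong (_% a) (+-identityʳ y) ⟩
    y % a                 ≡⟨ m<n⇒m%n≡m y<a ⟩
    y                     ∎))

module Intervals (b : ℕ) where

  data Zone (o : ℕ) : Set where
    low  : o < b → Zone o
    mid  : b ≤ o → o < b + b → Zone o
    high : b + b ≤ o → Zone o

  zone : ∀ o → Zone o
  zone o with o <? b | o <? b + b
  ... | yes o<b | _         = low o<b
  ... | no  o≮b | yes o<2b = mid (≮⇒≥ o≮b) o<2b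
  ... | no  _   | no  o≮2b = high (≮⇒≥ o≮2b)

  lower : ℕ → ℕ
  lower o with zone o
  ... | low _ = o
  ... | mid _ _ = 0
  ... | high _ = 0

  upper : ℕ → ℕ
  upper o with zone o
  ... | low _ = o
  ... | mid _ _ = o ∸ b
  ... | high _ = b

  lower≤upper : ∀ o → lower o ≤ upper o
  lower≤upper o with zone o
  ... | low _ = ≤-refl
  ... | mid _ _ = z≤n
  ... | high _ = z≤n

  Meet : ℕ → ℕ → Set
  Meet o o′ = lower o ≤ upper o′ × lower o′ ≤ upper o

  module _ {a o o′ k : ℕ} (b≤k : b ≤ k) (k+b≤a : k + b ≤ a) where

    no-wrap : CyclicShift a o o′ k → o′ < b → o ≡ o′ + k
    no-wrap (inj₁ o≡o′+k) _ = o≡o′+k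
    no-wrap (inj₂ o+a≡o′+k) o′<b = ⊥-elim (<⇒≱ o′+k<a (subst (a ≤_) o+a≡o′+k (m≤n+m a o)))
      where
      o′+k<a : o′ + k < a
      o′+k<a = <-≤-trans (+-monoˡ-< k o′<b) (≤-trans (≤-reflexive (+-comm b k)) k+b≤a)

    wrap : CyclicShift a o o′ k → o < b → o + a ≡ o′ + k
    wrap (inj₂ o+a≡o′+k) _ = o+a≡o′+k
    wrap (inj₁ o≡o′+k) o<b = ⊥-elim (<⇒≱ o<b (≤-trans b≤k (subst (k ≤_) (sym o≡o′+k) (m≤n+m k o′))))

    farOffsetsMeet : CyclicShift a o o′ k → Meet o o′
    farOffsetsMeet shift = lower-o≤upper-o′ , lower-o′≤upper-o
      where
      lower-o≤upper-o′ : lower o ≤ upper o′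
      lower-o≤upper-o′ with zone o | zone o′
      ... | mid _ _ | _ = z≤n
      ... | high _  | _ = z≤n
      ... | low o<b | low o′<b = ⊥-elim (<⇒≱ o<b (≤-trans b≤k (subst (k ≤_) (sym (no-wrap shift o′<b)) (m≤n+m k o′))))
      ... | low o<b | mid _ _ = m+n≤o⇒m≤o∸n o (+-cancelʳ-≤ k (o + b) o′
            (subst (o + b + k ≤_) (wrap shift o<b) (≤-trans (≤-reflexive (+-assoc o b k))
              (+-monoʳ-≤ o (≤-trans (≤-reflexive (+-comm b k)) k+b≤a)))))
      ... | low o<b | high _ = <⇒≤ o<b
      lower-o′≤upper-o : lower o′ ≤ upper o
      lower-o′≤upper-o with zone o′ | zone o
      ... | mid _ _  | _ = z≤n
      ... | high _   | _ = z≤n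
      ... | low o′<b | low _ = subst (o′ ≤_) (sym (no-wrap shift o′<b)) (m≤m+n o′ k)
      ... | low o′<b | mid _ _ = m+n≤o⇒m≤o∸n o′ (subst (o′ + b ≤_) (sym (no-wrap shift o′<b)) (+-monoʳ-≤ o′ b≤k))
      ... | low o′<b | high _ = <⇒≤ o′<b

  nearOffsetsApart : ∀ {t e} → t < b → 0 < e → e < b → ¬ Meet (t + e) t
  nearOffsetsApart {t} {e} t<b 0<e e<b (lower-te≤upper-t , lower-t≤upper-te) with zone t
  ... | mid b≤t _ = <⇒≱ t<b b≤t
  ... | high 2b≤t = <⇒≱ t<b (≤-trans (m≤m+n b b) 2b≤t)
  ... | low _ with zone (t + e)
  ...   | low _ = <⇒≱ (m<m+n t 0<e) lower-te≤upper-t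
  ...   | mid b≤t+e _ = <⇒≱ e<b (+-cancelˡ-≤ t b e (m≤o∸n⇒m+n≤o t b≤t+e lower-t≤upper-te))
  ...   | high 2b≤t+e = <⇒≱ (+-mono-< t<b e<b) 2b≤t+e

module BoxRepresentation (a b m : ℕ) .{{_ : NonZero a}} .{{_ : NonZero b}}
                         (2b≤a : b + b ≤ a) (a≤mb : a ≤ m * b) where
  open Cycle a
  open Intervals b
  open ≡-Reasoning

  offset : Fin m → ℕ → ℕ
  offset i = rotate (toℕ i * b)

  box : Fin a → Box m
  box u = record
    { lo    = λ i → pos (lower (offset i (toℕ u)))
    ; hi    = λ i → pos (upper (offset i (toℕ u)))
    ; lo≤hi = λ i → +≤+ (lower≤upper (offset i (toℕ u)))
    }

  MeetEverywhere : Fin a → Fin a → Set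
  MeetEverywhere u v = ∀ i → Meet (offset i (toℕ u)) (offset i (toℕ v))

  meet⇒intersect : ∀ {u v} → MeetEverywhere u v → Intersect (box u) (box v)
  meet⇒intersect meet i = +≤+ (proj₁ (meet i)) , +≤+ (proj₂ (meet i))

  intersect⇒meet : ∀ {u v} → Intersect (box u) (box v) → MeetEverywhere u v
  intersect⇒meet I i = drop‿+≤+ (proj₁ (I i)) , drop‿+≤+ (proj₂ (I i))

  -- Rebasing keeps adjacent vertices at the same far distance, so they meet everywhere.
  adjacent⇒meet : ∀ {u v} → CircAdj a b u v → MeetEverywhere u v
  adjacent⇒meet {u} {v} (_ , k , b≤k , k≤a∸b , shift) i =
    farOffsetsMeet b≤k k+b≤a
      (mod⇒shift (rotate<a s (toℕ v)) k≤a
        (rotate-shift s {toℕ u} {toℕ v} {k} (shift⇒mod {y = toℕ v} (toℕ<n u) shift)))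
    where
    s : ℕ
    s = toℕ i * b
    k+b≤a : k + b ≤ a
    k+b≤a = m≤o∸n⇒m+n≤o k (≤-trans (m≤m+n b b) 2b≤a) k≤a∸b
    k≤a : k ≤ a
    k≤a = ≤-trans (m≤m+n k b) k+b≤a

  -- Vertices y and y+e with 0 < e < b are separated in the coordinate based at the
  -- largest multiple of b not exceeding y, where their offsets are y % b and y % b + e.
  nearSeparated : ∀ {x y e} → y < a → 0 < e → e < b → x ≡ (y + e) % a →
                  ∃ λ i → ¬ Meet (offset i x) (offset i y)
  nearSeparated {x} {y} {e} y<a 0<e e<b x≡y+e = i , apart
    where
    y/b<m : y / b < m
    y/b<m = m<n*o⇒m/o<n (<-≤-trans y<a a≤mb)
    i : Fin m
    i = fromℕ< y/b<m
    offset-y : offset i y ≡ y % b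
    offset-y = begin
      rotate (toℕ i * b) y  ≡⟨ cong (λ q → rotate (q * b) y) (toℕ-fromℕ< y/b<m) ⟩
      rotate (y / b * b) y  ≡⟨ rotate-below (m/n*n≤m y b) y<a ⟩
      y ∸ y / b * b         ≡⟨ m%n≡m∸m/n*n y b ⟨
      y % b                 ∎
    offset-x : offset i x ≡ y % b + e
    offset-x = begin
      offset i x            ≡⟨ rotate-shift (toℕ i * b) x≡y+e ⟩
      (offset i y + e) % a  ≡⟨ cong (λ o → (o + e) % a) offset-y ⟩
      (y % b + e) % a       ≡⟨ m<n⇒m%n≡m (<-≤-trans (+-mono-< (m%n<n y b) e<b) 2b≤a) ⟩
      y % b + e             ∎
    apart : ¬ Meet (offset i x) (offset i y)
    apart rewrite offset-x | offset-y = nearOffsetsApart (m%n<n y b) 0<e e<b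

  -- Distinct vertices meeting everywhere are at cyclic distance d with b ≤ d ≤ a-b:
  -- a distance below b, or above a-b read backwards, would separate them.
  module _ {u v : Fin a} (u≢v : u ≢ v) (meet : MeetEverywhere u v) where
    private
      d : ℕ
      d = rotate (toℕ v) (toℕ u)
      d<a : d < a
      d<a = rotate<a (toℕ v) (toℕ u)
      u≡v+d : toℕ u ≡ (toℕ v + d) % a
      u≡v+d = rotate-distance (toℕ<n u) (toℕ<n v)

      not-separated : ¬ ∃ λ i → ¬ Meet (offset i (toℕ u)) (offset i (toℕ v))
      not-separated (i , apart) = apart (meet i)
      not-separated′ : ¬ ∃ λ i → ¬ Meet (offset i (toℕ v)) (offset i (toℕ u))
      not-separated′ (i , apart) = apart (swap (meet i))

    meet⇒adjacent : CircAdj a b u v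
    meet⇒adjacent with d <? b | d + b ≤? a
    ... | yes d<b | _ = ⊥-elim (not-separated (nearSeparated (toℕ<n v) 0<d d<b u≡v+d))
      where
      0<d : 0 < d
      0<d = distance-positive (toℕ<n u) (toℕ<n v) (λ eq → u≢v (toℕ-injective eq))
    ... | no d≮b | yes d+b≤a =
      u≢v , d , ≮⇒≥ d≮b , m+n≤o⇒m≤o∸n d d+b≤a , mod⇒shift (toℕ<n v) (<⇒≤ d<a) u≡v+d
    ... | no _ | no d+b≰a = ⊥-elim (not-separated′ (nearSeparated (toℕ<n u) (m<n⇒0<n∸m d<a)
                                       (m<n+o⇒m∸n<o a d (≰⇒> d+b≰a))
                                       (reverse-distance (toℕ<n v) (<⇒≤ d<a) u≡v+d)))

  boxRepresentable : BoxRepresentable a b m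
  boxRepresentable = box , λ u v u≢v →
    mk⇔ (λ adj → meet⇒intersect (adjacent⇒meet adj)) (λ I → meet⇒adjacent u≢v (intersect⇒meet I))

multipleInWindow : ∀ b r .{{_ : NonZero r}} → ∃ λ q → b ≤ q * r × q * r < b + r
multipleInWindow zero r = 0 , z≤n , >-nonZero⁻¹ r
multipleInWindow (suc b) r with multipleInWindow b r
... | q , b≤qr , qr<b+r with m≤n⇒m<n∨m≡n b≤qr
...   | inj₁ b<qr = q , b<qr , <-trans qr<b+r (n<1+n (b + r))
...   | inj₂ b≡qr = suc q
        , subst (λ z → suc b ≤ r + z) b≡qr (+-monoˡ-≤ b (>-nonZero⁻¹ r))
        , subst (λ z → r + z < suc b + r) b≡qr (s≤s (≤-reflexive (+-comm r b)))

twoBlocks : ∀ {n} b → 2 ≤ n → b + b ≤ n * b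
twoBlocks {n} b 2≤n = subst (λ z → b + z ≤ n * b) (+-identityʳ b) (*-monoˡ-≤ b 2≤n)

module Vertices (a b : ℕ) .{{_ : NonZero a}} .{{_ : NonZero b}} where
  open Cycle a
  open ≡-Reasoning

  vertex : ℕ → Fin a
  vertex x = fromℕ< (m%n<n x a)

  toℕ-vertex : ∀ x → toℕ (vertex x) ≡ x % a
  toℕ-vertex x = toℕ-fromℕ< (m%n<n x a)

  vertex-period : ∀ x → vertex (x + a) ≡ vertex x
  vertex-period x = toℕ-injective (begin
    toℕ (vertex (x + a))  ≡⟨ toℕ-vertex (x + a) ⟩
    (x + a) % a           ≡⟨ [m+n]%n≡m%n x a ⟩
    x % a                 ≡⟨ toℕ-vertex x ⟨
    toℕ (vertex x)        ∎)

  farStep : ∀ x {k} → b ≤ k → k + b ≤ a → CircAdj a b (vertex (x + k)) (vertex x)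
  farStep x {k} b≤k k+b≤a = moves , k , b≤k , m+n≤o⇒m≤o∸n k k+b≤a , shift
    where
    k<a : k < a
    k<a = <-≤-trans (m<m+n k (>-nonZero⁻¹ b)) k+b≤a
    shift : CyclicShift a (toℕ (vertex (x + k))) (toℕ (vertex x)) k
    shift = mod⇒shift (toℕ<n (vertex x)) (<⇒≤ k<a) (begin
      toℕ (vertex (x + k))      ≡⟨ toℕ-vertex (x + k) ⟩
      (x + k) % a               ≡⟨ %-absorbˡ x k ⟨
      (x % a + k) % a           ≡⟨ cong (λ y → (y + k) % a) (toℕ-vertex x) ⟨
      (toℕ (vertex x) + k) % a  ∎)
    moves : vertex (x + k) ≢ vertex x
    moves eq = shift-moves shift (<-≤-trans (>-nonZero⁻¹ b) b≤k) k<a (cong toℕ eq)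

module ChromaticBound (n b r : ℕ) .{{_ : NonZero b}} .{{_ : NonZero r}} (2≤n : 2 ≤ n) where
  open ≡-Reasoning

  a : ℕ
  a = n * b + r

  instance
    a-nonZero : NonZero a
    a-nonZero = >-nonZero (<-≤-trans (>-nonZero⁻¹ r) (m≤n+m r (n * b)))

  open Vertices a b

  -- Among x, x+b, …, x+nb every pair except the extreme one is adjacent,
  -- as their distance δ·b satisfies b ≤ δ·b ≤ (n-1)·b ≤ a-b.
  multiplesAdjacent : ∀ x {m m′} → m < m′ → m′ ≤ n → ¬ (m ≡ 0 × m′ ≡ n) →
                      CircAdj a b (vertex (x + m′ * b)) (vertex (x + m * b))
  multiplesAdjacent x {m} {m′} m<m′ m′≤n not-extreme =
    subst (λ y → CircAdj a b (vertex y) (vertex (x + m * b))) step (farStep (x + m * b) b≤δb δb+b≤a)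
    where
    δ : ℕ
    δ = m′ ∸ m
    m+δ≡m′ : m + δ ≡ m′
    m+δ≡m′ = m+[n∸m]≡n (<⇒≤ m<m′)
    1+δ≤n : suc δ ≤ n
    1+δ≤n with m ≟ 0
    ... | yes refl = ≤∧≢⇒< m′≤n (λ m′≡n → not-extreme (refl , m′≡n))
    ... | no m≢0 = ≤-trans (+-monoˡ-≤ δ (n≢0⇒n>0 m≢0)) (subst (_≤ n) (sym m+δ≡m′) m′≤n)
    b≤δb : b ≤ δ * b
    b≤δb = subst (_≤ δ * b) (+-identityʳ b) (*-monoˡ-≤ b (m<n⇒0<n∸m m<m′))
    δb+b≤a : δ * b + b ≤ a
    δb+b≤a = ≤-trans (≤-reflexive (+-comm (δ * b) b)) (≤-trans (*-monoˡ-≤ b 1+δ≤n) (m≤m+n (n * b) r))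
    step : x + m * b + δ * b ≡ x + m′ * b
    step = begin
      x + m * b + δ * b    ≡⟨ +-assoc x (m * b) (δ * b) ⟩
      x + (m * b + δ * b)  ≡⟨ cong (x +_) (*-distribʳ-+ b m δ) ⟨
      x + (m + δ) * b      ≡⟨ cong (λ z → x + z * b) m+δ≡m′ ⟩
      x + m′ * b           ∎

  module _ {j} (j<1+n : j < suc n) (c : Fin a → Fin j)
           (proper : ∀ u v → CircAdj a b u v → c u ≢ c v) where

    colour : ℕ → Fin j
    colour x = c (vertex x)

    -- Pigeonhole on the n+1 vertices x + m·b: only the extreme pair may share a colour.
    extremesAgree : ∀ x → colour x ≡ colour (x + n * b)
    extremesAgree x with pigeonhole j<1+n (λ m → colour (x + toℕ m * b))
    ... | m , m′ , m<m′ , same with (toℕ m ≟ 0) ×-dec (toℕ m′ ≟ n)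
    ...   | yes (m≡0 , m′≡n) = begin
      colour x                   ≡⟨ cong colour (+-identityʳ x) ⟨
      colour (x + 0 * b)         ≡⟨ cong (λ z → colour (x + z * b)) m≡0 ⟨
      colour (x + toℕ m * b)     ≡⟨ same ⟩
      colour (x + toℕ m′ * b)    ≡⟨ cong (λ z → colour (x + z * b)) m′≡n ⟩
      colour (x + n * b)         ∎
    ...   | no not-extreme =
      ⊥-elim (proper _ _ (multiplesAdjacent x m<m′ (≤-pred (toℕ<n m′)) not-extreme) (sym same))

    -- Since x + r + n·b = x + a, the colouring is invariant under adding r.
    colourPeriodic : ∀ x → colour (x + r) ≡ colour x
    colourPeriodic x = begin
      colour (x + r)            ≡⟨ extremesAgree (x + r) ⟩
      colour (x + r + n * b)    ≡⟨ cong colour (+-assoc x r (n * b)) ⟩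
      colour (x + (r + n * b))  ≡⟨ cong (λ z → colour (x + z)) (+-comm r (n * b)) ⟩
      colour (x + a)            ≡⟨ cong c (vertex-period x) ⟩
      colour x                  ∎

    colourMultiples : ∀ q → colour (q * r) ≡ colour 0
    colourMultiples zero = refl
    colourMultiples (suc q) = begin
      colour (r + q * r)  ≡⟨ cong colour (+-comm r (q * r)) ⟩
      colour (q * r + r)  ≡⟨ colourPeriodic (q * r) ⟩
      colour (q * r)      ≡⟨ colourMultiples q ⟩
      colour 0            ∎

    -- The least multiple q·r ≥ b is adjacent to 0, yet has the colour of 0.
    noSmallColouring : ⊥
    noSmallColouring with multipleInWindow b r
    ... | q , b≤qr , qr<b+r = proper _ _ (farStep 0 b≤qr qr+b≤a) (colourMultiples q)
      where
      -- q·r + b ≤ (b + r) + b = 2b + r ≤ n·b + r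
      qr+b≤a : q * r + b ≤ a
      qr+b≤a = ≤-trans (+-monoˡ-≤ b (<⇒≤ qr<b+r))
                 (≤-trans (≤-reflexive (xy∙z≈xz∙y b r b)) (+-monoˡ-≤ r (twoBlocks b 2≤n)))

  chromaticLowerBound : ∀ {j} → Colourable a b j → suc n ≤ j
  chromaticLowerBound (c , proper) = ≮⇒≥ (λ j<1+n → noSmallColouring j<1+n c proper)

-- box(G_{nb+r,b}) ≤ n + 1 ≤ χ(G_{nb+r,b}).
theorem4p2 : (n b r : ℕ) → 2 ≤ n → 2 ≤ b → 1 ≤ r → r < b → b ∸ r ∸ 1 ≤ n →
    (χ : ℕ) → IsChromaticNumber (n * b + r) b χ →
    ∃ λ k → k ≤ χ × BoxRepresentable (n * b + r) b k
theorem4p2 n b r 2≤n 2≤b 1≤r r<b _ χ (colourable , _) =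
  suc n , chromaticLowerBound colourable , boxRepresentable
  where
  instance
    b-nonZero : NonZero b
    b-nonZero = >-nonZero (≤-trans (s≤s z≤n) 2≤b)
    r-nonZero : NonZero r
    r-nonZero = >-nonZero 1≤r

  open ChromaticBound n b r 2≤n

  2b≤a : b + b ≤ a
  2b≤a = ≤-trans (twoBlocks b 2≤n) (m≤m+n (n * b) r)
  a≤[1+n]b : a ≤ suc n * b
  a≤[1+n]b = ≤-trans (+-monoʳ-≤ (n * b) (<⇒≤ r<b)) (≤-reflexive (+-comm (n * b) b))

  open BoxRepresentation a b (suc n) 2b≤a a≤[1+n]b
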